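{- Let $\mathbf{w}$ be a word over $\{r,c\}$ of length $k$ and $n\ge1$. The map $\psi:\mathrm{BST}(\mathbf{w},n)\to S_{n+k}$ is injective.
   Context: Diagrams in English convention (rows top to bottom, columns left to right); content of the box in row $i$, column $j$ is $j-i$; a diagonal is the set of boxes of a given content. A border strip is a set of boxes forming a connected skew shape with no $2\times2$ square; its head is its box of maximal content. The simple diagram $(\mathbf{w},n)$: $(\emptyset,n)$ is the $n\times n$ square; $(c\mathbf{w},n)$ adjoins to $(\mathbf{w},n)$ a new column of $n$ boxes immediately left of the leftmost column with its bottom box in the bottom row; $(r\mathbf{w},n)$ adjoins a new row of $n$ boxes immediately below the bottom row with its leftmost box in the leftmost column. Diagonals are numbered $n+k,\dots,1$ starting from the diagonal containing the top-right box and going down in content. $\mathrm{BST}(\mathbf{w},n)$ is the set of fillings of $(\mathbf{w},n)$ with $1,\dots,n+k$, each used exactly $n$ times, rows weakly increasing left to right, columns weakly increasing top to bottom, boxes with each value forming a border strip; in each such tableau each diagonal $1,\dots,n+k$ contains exactly one head. $\psi(T)$ is the permutation $\sigma$ with $\sigma(j)=i$ whenever the head of the strip filled with $j$ lies in diagonal $i$. -}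

module Defs where

open import Data.Nat as ℕ using (ℕ; _≤_) renaming (_+_ to _+ℕ_)
open import Data.Integer as ℤ using (ℤ; +_; _-_; _⊔_) renaming (_+_ to _+ℤ_; _≤_ to _≤ℤ_)
open import Data.Product using (_×_; _,_; ∃; Σ)
open import Data.Sum using (_⊎_)
open import Data.List using (List; []; _∷_; _++_; map; length; filter; foldr; upTo)
open import Data.List.Membership.Propositional using (_∈_)
open import Relation.Binary.PropositionalEquality using (_≡_)
open import Relation.Binary.Construct.Closure.ReflexiveTransitive using (Star)
open import Relation.Nullary using (¬_)
open import Data.Bool using (if_then_else_)
open import Relation.Nullary.Decidable using (⌊_⌋)

data Letter : Set where
  r c : Letter

Word : Set
Word = List Letter

-- A box is (row , column), English convention, integer coordinates.
Box : Set
Box = ℤ × ℤ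

row col : Box → ℤ
row (i , j) = i
col (i , j) = j

content : Box → ℤ
content (i , j) = j - i

record SDiag : Set where
  constructor sdiag
  field
    leftCol   : ℤ
    bottomRow : ℤ
    boxes     : List Box

-- The n × n square occupies rows 0..n-1 and columns 0..n-1.
-- The top-right box is (0 , n-1); adding rows/columns never changes
-- the top row nor the rightmost column.
build : Word → ℕ → SDiag
build [] n = sdiag (+ 0) (+ n - + 1)
  (Data.List.concatMap (λ i → map (λ j → (+ i , + j)) (upTo n)) (upTo n))
build (c ∷ w) n with build w n
... | sdiag L B bs = sdiag (L - + 1) B
  (bs ++ map (λ t → (B - + t , L - + 1)) (upTo n))
build (r ∷ w) n with build w n
... | sdiag L B bs = sdiag L (B +ℤ + 1)
  (bs ++ map (λ t → (B +ℤ + 1 , L +ℤ + t)) (upTo n))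

Diagram : Word → ℕ → List Box
Diagram w n = SDiag.boxes (build w n)

-- Diagonal number: the diagonal of the top-right box (0 , n-1), of content
-- n-1, is numbered n+k; numbers decrease by one with the content.
diagNum : Word → Box → ℤ
diagNum w b = content b +ℤ + (length w +ℕ 1)

Filling : Set
Filling = Box → ℕ

InStrip : Word → ℕ → Filling → ℕ → Box → Set
InStrip w n T v b = (b ∈ Diagram w n) × (T b ≡ v)

Adjacent : Box → Box → Set
Adjacent (i , j) (i' , j') =
  ((i ≡ i') × ((j' ≡ j +ℤ + 1) ⊎ (j ≡ j' +ℤ + 1))) ⊎
  ((j ≡ j') × ((i' ≡ i +ℤ + 1) ⊎ (i ≡ i' +ℤ + 1)))

IsSkewShape : (Box → Set) → Set
IsSkewShape S = ∀ a b x y → S a → S b →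
  row a ≤ℤ x → x ≤ℤ row b → col a ≤ℤ y → y ≤ℤ col b → S (x , y)

IsConnected : (Box → Set) → Set
IsConnected S = ∀ a b → S a → S b →
  Star (λ p q → S p × S q × Adjacent p q) a b

No2x2 : (Box → Set) → Set
No2x2 S = ∀ i j → ¬ (S (i , j) × S (i , j +ℤ + 1) × S (i +ℤ + 1 , j) × S (i +ℤ + 1 , j +ℤ + 1))

IsBorderStrip : (Box → Set) → Set
IsBorderStrip S = IsSkewShape S × IsConnected S × No2x2 S

count : Word → ℕ → Filling → ℕ → ℕ
count w n T v = length (filter (λ b → T b ℕ.≟ v) (Diagram w n))

record IsBST (w : Word) (n : ℕ) (T : Filling) : Set where
  field
    values   : ∀ b → b ∈ Diagram w n → (1 ≤ T b) × (T b ≤ n +ℕ length w)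
    counts   : ∀ v → 1 ≤ v → v ≤ n +ℕ length w → count w n T v ≡ n
    rowsWeak : ∀ i j j' → (i , j) ∈ Diagram w n → (i , j') ∈ Diagram w n →
               j ≤ℤ j' → T (i , j) ≤ T (i , j')
    colsWeak : ∀ i i' j → (i , j) ∈ Diagram w n → (i' , j) ∈ Diagram w n →
               i ≤ℤ i' → T (i , j) ≤ T (i' , j)
    strips   : ∀ v → 1 ≤ v → v ≤ n +ℕ length w → IsBorderStrip (InStrip w n T v)

-- ψ(T)(j): the diagonal number of the head (box of maximal content) of the
-- strip filled with j.  Computed as the maximum of diagonal numbers of boxes
-- filled with j (all ≥ 1 on the diagram; 0 is returned for an empty strip,
-- which never happens in a BST).
ψ : Word → ℕ → Filling → ℕ → ℤ
ψ w n T j = foldr (λ b acc → if ⌊ T b ℕ.≟ j ⌋ then diagNum w b ⊔ acc else acc)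
                  (+ 0) (Diagram w n)

module Submission where

-- A border strip meets each diagonal at most once (two boxes on one
--     diagonal would span a 2 × 2 square of the skew shape) and, being connected,
--     meets every diagonal between its extreme ones.  So a strip of n boxes with
--     head on content M occupies exactly the contents M - d, …, M, and ψ records
--     M: whether the strip of v meets a given diagonal is determined by ψ(v).
-- (3) Induction.  Along a diagonal the entries of a BST increase strictly going
--     down.  If ψ(T) = ψ(T') and T, T' agree above box b on its diagonal, the
--     strip of v = T' b in T meets that diagonal in a box c; c cannot lie above b,
--     so T b ≤ T c = v.  By symmetry T b = T' b, and induction on the row of b
--     concludes.

open import Defs
open import Data.Nat as ℕ using (ℕ; zero; suc; _≤_; _+_; _∸_; z≤n; s≤s)
import Data.Nat.Properties as ℕP
open import Data.Integer as ℤ using (ℤ; +_; 0ℤ; _⊔_) renaming (_≤_ to _≤ℤ_; _<_ to _<ℤ_)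
import Data.Integer.Properties as ℤP
open import Data.Integer.Tactic.RingSolver using (solve-∀)
open import Data.Product using (_×_; _,_; ∃; ∃₂; proj₁; proj₂)
open import Data.Sum using (_⊎_; inj₁; inj₂)
open import Data.List using (List; []; _∷_; _++_; map; length; filter; foldr; upTo; concatMap; cartesianProductWith)
open import Data.List.Properties using (length-map; length-upTo)
open import Data.List.Membership.Propositional using (_∈_)
open import Data.List.Membership.Propositional.Properties
open import Data.List.Relation.Unary.Any using (here; there)
import Data.List.Relation.Unary.All as All
import Data.List.Relation.Unary.All.Properties as AllP
open import Data.List.Relation.Unary.AllPairs using ([]; _∷_)
open import Data.List.Relation.Unary.Unique.Propositional using (Unique)
import Data.List.Relation.Unary.Unique.Propositional.Properties as UniqueP
open import Data.List.Extrema ℤP.≤-totalOrder using (argmax; argmin; argmax-all; argmin-all; f[⊥]≤f[argmax]; f[xs]≤f[argmax]; f[argmin]≤f[⊤]; f[argmin]≤f[xs])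
open import Relation.Binary.PropositionalEquality
open import Relation.Binary.Construct.Closure.ReflexiveTransitive using (Star; ε; _◅_)
open import Relation.Nullary using (¬_; Dec; yes; no)
open import Relation.Nullary.Decidable using (⌊_⌋)
open import Data.Bool using (if_then_else_)
open import Relation.Binary using (tri<; tri≈; tri>)
open import Data.Empty using (⊥-elim)

-- c ≤ d certified by a nonnegative difference; every linear inequality below is
-- proved this way, the identity for the difference coming from the ring solver.
≤-byDiff : ∀ {c d} e → 0ℤ ≤ℤ e → d ℤ.- c ≡ e → c ≤ℤ d
≤-byDiff e 0≤e d-c≡e = ℤP.0≤i-j⇒j≤i (subst (0ℤ ≤ℤ_) (sym d-c≡e) 0≤e)

diff≥0 : ∀ {a b} → a ≤ℤ b → 0ℤ ≤ℤ b ℤ.- a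
diff≥0 = ℤP.i≤j⇒0≤j-i

+≥0 : ∀ t → 0ℤ ≤ℤ + t
+≥0 t = ℤ.+≤+ z≤n

_⊕_ : ∀ {a b} → 0ℤ ≤ℤ a → 0ℤ ≤ℤ b → 0ℤ ≤ℤ a ℤ.+ b
p ⊕ q = ℤP.+-mono-≤ p q
infixl 6 _⊕_

<⇒+1≤ : ∀ {i i'} → i <ℤ i' → i ℤ.+ + 1 ≤ℤ i'
<⇒+1≤ {i} {i'} i<i' = subst (_≤ℤ i') (ℤP.+-comm (+ 1) i) (ℤP.i<j⇒suc[i]≤j i<i')

≤+1 : ∀ j → j ≤ℤ j ℤ.+ + 1
≤+1 j = ℤP.i≤i+j j (+ 1)

+1≤⇒≱ : ∀ {x y} → x ℤ.+ + 1 ≤ℤ y → ¬ (y ≤ℤ x)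
+1≤⇒≱ {x} x+1≤y = ℤP.<⇒≱ (ℤP.suc[i]≤j⇒i<j (subst (_≤ℤ _) (ℤP.+-comm x (+ 1)) x+1≤y))

diagonal-right : ∀ {i j i' j'} → j ℤ.- i ≡ j' ℤ.- i' → i ℤ.+ + 1 ≤ℤ i' → j ℤ.+ + 1 ≤ℤ j'
diagonal-right {i} {j} {i'} {j'} same i+1≤i' = ≤-byDiff _ (diff≥0 i+1≤i') (begin
    j' ℤ.- (j ℤ.+ + 1)                                       ≡⟨ shift j i j' i' ⟩
    ((j' ℤ.- i') ℤ.- (j ℤ.- i)) ℤ.+ (i' ℤ.- (i ℤ.+ + 1))   ≡⟨ cong (λ z → (z ℤ.- (j ℤ.- i)) ℤ.+ (i' ℤ.- (i ℤ.+ + 1))) (sym same) ⟩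
    ((j ℤ.- i) ℤ.- (j ℤ.- i)) ℤ.+ (i' ℤ.- (i ℤ.+ + 1))     ≡⟨ cancel (j ℤ.- i) _ ⟩
    i' ℤ.- (i ℤ.+ + 1)                                       ∎)
  where
  open ≡-Reasoning
  shift : ∀ j i j' i' → j' ℤ.- (j ℤ.+ + 1) ≡ ((j' ℤ.- i') ℤ.- (j ℤ.- i)) ℤ.+ (i' ℤ.- (i ℤ.+ + 1))
  shift = solve-∀
  cancel : ∀ a x → (a ℤ.- a) ℤ.+ x ≡ x
  cancel = solve-∀

row-content-injective : ∀ {a b} → row a ≡ row b → content a ≡ content b → a ≡ b
row-content-injective {i , j} {.i , j'} refl same = cong (i ,_) (trans (sym (undo j i)) (trans (cong (ℤ._+ i) same) (undo j' i)))
  where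
  undo : ∀ j i → (j ℤ.- i) ℤ.+ i ≡ j
  undo = solve-∀

addColumn addRow : ℕ → SDiag → SDiag
addColumn n (sdiag L B bs) = sdiag (L ℤ.- + 1) B (bs ++ map (λ t → (B ℤ.- + t , L ℤ.- + 1)) (upTo n))
addRow n (sdiag L B bs) = sdiag L (B ℤ.+ + 1) (bs ++ map (λ t → (B ℤ.+ + 1 , L ℤ.+ + t)) (upTo n))

build-c : ∀ w n → build (c ∷ w) n ≡ addColumn n (build w n)
build-c w n with build w n
... | sdiag L B bs = refl

build-r : ∀ w n → build (r ∷ w) n ≡ addRow n (build w n)
build-r w n with build w n
... | sdiag L B bs = refl

-- The first four facts are what the rest of the proof uses; the rest (the bottom-left
-- box (B , L) has content ≥ 1 - (n + k), B ≥ n - 1, the last n boxes of column L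
-- and the first n boxes of row B are present) keep the induction going.
record Shape (n k : ℕ) (L B : ℤ) (bs : List Box) : Set where
  field
    unique      : Unique bs
    rowsFromTop : ∀ {b} → b ∈ bs → 0ℤ ≤ℤ row b
    contentLow  : ∀ {b} → b ∈ bs → + 1 ≤ℤ content b ℤ.+ + (k + n)
    rectangle   : ∀ {i j i' j'} → (i , j) ∈ bs → (i' , j') ∈ bs → i ≤ℤ i' → j ≤ℤ j' → (i , j') ∈ bs
    leftmost    : ∀ {b} → b ∈ bs → L ≤ℤ col b
    bottommost  : ∀ {b} → b ∈ bs → row b ≤ℤ B
    cornerLow   : + 1 ≤ℤ (L ℤ.- B) ℤ.+ + (k + n)
    tall        : + n ≤ℤ B ℤ.+ + 1
    leftColumn  : ∀ t → t ℕ.< n → (B ℤ.- + t , L) ∈ bs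
    bottomRow   : ∀ t → t ℕ.< n → (B , L ℤ.+ + t) ∈ bs

∈-map-upTo⁻ : ∀ {n} (f : ℕ → Box) {b} → b ∈ map f (upTo n) → ∃ λ t → t ℕ.< n × b ≡ f t
∈-map-upTo⁻ f p with t , q , e ← ∈-map⁻ f p = t , ∈-upTo⁻ q , e

∈-map-upTo⁺ : ∀ {n} (f : ℕ → Box) {t} → t ℕ.< n → f t ∈ map f (upTo n)
∈-map-upTo⁺ f t<n = ∈-map⁺ f (∈-upTo⁺ t<n)

contentLow-step : ∀ a x → + 1 ≤ℤ a ℤ.+ x → + 1 ≤ℤ a ℤ.+ (+ 1 ℤ.+ x)
contentLow-step a x p = ≤-byDiff _ (diff≥0 p ⊕ +≥0 1) (step a x)
  where
  step : ∀ a x → (a ℤ.+ (+ 1 ℤ.+ x)) ℤ.- + 1 ≡ ((a ℤ.+ x) ℤ.- + 1) ℤ.+ + 1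
  step = solve-∀

module _ {n k : ℕ} {L B : ℤ} {bs : List Box} (S : Shape n k L B bs) where
  open Shape S

  private
    newBox : ℕ → Box
    newBox t = (B ℤ.- + t , L ℤ.- + 1)

    L≰L-1 : ¬ (L ≤ℤ L ℤ.- + 1)
    L≰L-1 = +1≤⇒≱ (ℤP.≤-reflexive (restore L))
      where
      restore : ∀ L → (L ℤ.- + 1) ℤ.+ + 1 ≡ L
      restore = solve-∀

    new-injective : ∀ {x y} → newBox x ≡ newBox y → x ≡ y
    new-injective {x} {y} e = ℤP.+-injective (trans (sym (back B (+ x))) (trans (cong (λ z → B ℤ.- proj₁ z) e) (back B (+ y))))
      where
      back : ∀ B t → B ℤ.- (B ℤ.- t) ≡ t
      back = solve-∀

  addColumn-shape : Shape n (suc k) (L ℤ.- + 1) B (bs ++ map newBox (upTo n))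
  addColumn-shape = record
    { unique = UniqueP.++⁺ unique (UniqueP.map⁺ new-injective (UniqueP.upTo⁺ n)) disjoint
    ; rowsFromTop = rowsFromTop'
    ; contentLow = contentLow'
    ; rectangle = rectangle'
    ; leftmost = leftmost'
    ; bottommost = bottommost'
    ; cornerLow = subst (+ 1 ≤ℤ_) (sym (corner L B (+ (k + n)))) cornerLow
    ; tall = tall
    ; leftColumn = λ t t<n → ∈-++⁺ʳ bs (∈-map-upTo⁺ newBox t<n)
    ; bottomRow = bottomRow'
    }
    where
    NC : List Box
    NC = map newBox (upTo n)
    corner : ∀ L B x → ((L ℤ.- + 1) ℤ.- B) ℤ.+ (+ 1 ℤ.+ x) ≡ (L ℤ.- B) ℤ.+ x
    corner = solve-∀
    disjoint : ∀ {v} → ¬ (v ∈ bs × v ∈ NC)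
    disjoint (p , q) with t , _ , refl ← ∈-map-upTo⁻ newBox q = L≰L-1 (leftmost p)
    leftmost' : ∀ {b} → b ∈ bs ++ NC → (L ℤ.- + 1) ≤ℤ col b
    leftmost' p with ∈-++⁻ bs p
    ... | inj₁ q = ℤP.≤-trans (ℤP.i-j≤i L (+ 1)) (leftmost q)
    ... | inj₂ q with t , _ , refl ← ∈-map-upTo⁻ newBox q = ℤP.≤-refl
    bottommost' : ∀ {b} → b ∈ bs ++ NC → row b ≤ℤ B
    bottommost' p with ∈-++⁻ bs p
    ... | inj₁ q = bottommost q
    ... | inj₂ q with t , _ , refl ← ∈-map-upTo⁻ newBox q = ℤP.i-j≤i B (+ t)
    rowsFromTop' : ∀ {b} → b ∈ bs ++ NC → 0ℤ ≤ℤ row b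
    rowsFromTop' p with ∈-++⁻ bs p
    ... | inj₁ q = rowsFromTop q
    ... | inj₂ q with t , t<n , refl ← ∈-map-upTo⁻ newBox q = ≤-byDiff _ (diff≥0 tall ⊕ diff≥0 (ℤ.+≤+ t<n)) (rowEq B (+ t) (+ n))
      where
      rowEq : ∀ B t N → (B ℤ.- t) ℤ.- 0ℤ ≡ ((B ℤ.+ + 1) ℤ.- N) ℤ.+ (N ℤ.- (+ 1 ℤ.+ t))
      rowEq = solve-∀
    contentLow' : ∀ {b} → b ∈ bs ++ NC → + 1 ≤ℤ content b ℤ.+ + (suc k + n)
    contentLow' {b} p with ∈-++⁻ bs p
    ... | inj₁ q = contentLow-step (content b) (+ (k + n)) (contentLow q)
    ... | inj₂ q with t , t<n , refl ← ∈-map-upTo⁻ newBox q = ≤-byDiff _ (diff≥0 cornerLow ⊕ +≥0 t) (contentEq L B (+ t) (+ (k + n)))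
      where
      contentEq : ∀ L B t x → (((L ℤ.- + 1) ℤ.- (B ℤ.- t)) ℤ.+ (+ 1 ℤ.+ x)) ℤ.- + 1 ≡ (((L ℤ.- B) ℤ.+ x) ℤ.- + 1) ℤ.+ t
      contentEq = solve-∀
    bottomRow' : ∀ t → t ℕ.< n → (B , (L ℤ.- + 1) ℤ.+ + t) ∈ bs ++ NC
    bottomRow' zero t<n = subst (_∈ bs ++ NC) (cong₂ _,_ (ℤP.+-identityʳ B) (sym (ℤP.+-identityʳ (L ℤ.- + 1)))) (∈-++⁺ʳ bs (∈-map-upTo⁺ newBox t<n))
    bottomRow' (suc t) t<n = subst (_∈ bs ++ NC) (cong (B ,_) (sym (colEq L (+ t)))) (∈-++⁺ˡ (bottomRow t (ℕP.<-trans (ℕP.n<1+n t) t<n)))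
      where
      colEq : ∀ L t → (L ℤ.- + 1) ℤ.+ (+ 1 ℤ.+ t) ≡ L ℤ.+ t
      colEq = solve-∀
    rectangle' : ∀ {i j i' j'} → (i , j) ∈ bs ++ NC → (i' , j') ∈ bs ++ NC → i ≤ℤ i' → j ≤ℤ j' → (i , j') ∈ bs ++ NC
    rectangle' p p' ii jj with ∈-++⁻ bs p | ∈-++⁻ bs p'
    ... | inj₁ q | inj₁ q' = ∈-++⁺ˡ (rectangle q q' ii jj)
    ... | inj₁ q | inj₂ q' with t , _ , refl ← ∈-map-upTo⁻ newBox q' = ⊥-elim (L≰L-1 (ℤP.≤-trans (leftmost q) jj))
    ... | inj₂ q | inj₁ q' with t , t<n , refl ← ∈-map-upTo⁻ newBox q = ∈-++⁺ˡ (rectangle (leftColumn t t<n) q' ii (leftmost q'))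
    ... | inj₂ q | inj₂ q' with t , _ , refl ← ∈-map-upTo⁻ newBox q | t' , _ , refl ← ∈-map-upTo⁻ newBox q' = p

module _ {n k : ℕ} {L B : ℤ} {bs : List Box} (S : Shape n k L B bs) where
  open Shape S

  private
    newBox : ℕ → Box
    newBox t = (B ℤ.+ + 1 , L ℤ.+ + t)

    new-injective : ∀ {x y} → newBox x ≡ newBox y → x ≡ y
    new-injective {x} {y} e = ℤP.+-injective (trans (sym (back L (+ x))) (trans (cong (λ z → proj₂ z ℤ.- L) e) (back L (+ y))))
      where
      back : ∀ L t → (L ℤ.+ t) ℤ.- L ≡ t
      back = solve-∀

  addRow-shape : Shape n (suc k) L (B ℤ.+ + 1) (bs ++ map newBox (upTo n))
  addRow-shape = record
    { unique = UniqueP.++⁺ unique (UniqueP.map⁺ new-injective (UniqueP.upTo⁺ n)) disjoint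
    ; rowsFromTop = rowsFromTop'
    ; contentLow = contentLow'
    ; rectangle = rectangle'
    ; leftmost = leftmost'
    ; bottommost = bottommost'
    ; cornerLow = subst (+ 1 ≤ℤ_) (sym (corner L B (+ (k + n)))) cornerLow
    ; tall = ≤-byDiff _ (diff≥0 tall ⊕ +≥0 1) (tallEq B (+ n))
    ; leftColumn = leftColumn'
    ; bottomRow = λ t t<n → ∈-++⁺ʳ bs (∈-map-upTo⁺ newBox t<n)
    }
    where
    NR : List Box
    NR = map newBox (upTo n)
    corner : ∀ L B x → (L ℤ.- (B ℤ.+ + 1)) ℤ.+ (+ 1 ℤ.+ x) ≡ (L ℤ.- B) ℤ.+ x
    corner = solve-∀
    tallEq : ∀ B N → ((B ℤ.+ + 1) ℤ.+ + 1) ℤ.- N ≡ ((B ℤ.+ + 1) ℤ.- N) ℤ.+ + 1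
    tallEq = solve-∀
    disjoint : ∀ {v} → ¬ (v ∈ bs × v ∈ NR)
    disjoint (p , q) with t , _ , refl ← ∈-map-upTo⁻ newBox q = +1≤⇒≱ ℤP.≤-refl (bottommost p)
    leftmost' : ∀ {b} → b ∈ bs ++ NR → L ≤ℤ col b
    leftmost' p with ∈-++⁻ bs p
    ... | inj₁ q = leftmost q
    ... | inj₂ q with t , _ , refl ← ∈-map-upTo⁻ newBox q = ℤP.i≤i+j L (+ t)
    bottommost' : ∀ {b} → b ∈ bs ++ NR → row b ≤ℤ B ℤ.+ + 1
    bottommost' p with ∈-++⁻ bs p
    ... | inj₁ q = ℤP.≤-trans (bottommost q) (≤+1 B)
    ... | inj₂ q with t , _ , refl ← ∈-map-upTo⁻ newBox q = ℤP.≤-refl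
    rowsFromTop' : ∀ {b} → b ∈ bs ++ NR → 0ℤ ≤ℤ row b
    rowsFromTop' p with ∈-++⁻ bs p
    ... | inj₁ q = rowsFromTop q
    ... | inj₂ q with t , t<n , refl ← ∈-map-upTo⁻ newBox q = ≤-byDiff _ (diff≥0 tall ⊕ +≥0 n) (rowEq B (+ n))
      where
      rowEq : ∀ B N → (B ℤ.+ + 1) ℤ.- 0ℤ ≡ ((B ℤ.+ + 1) ℤ.- N) ℤ.+ N
      rowEq = solve-∀
    contentLow' : ∀ {b} → b ∈ bs ++ NR → + 1 ≤ℤ content b ℤ.+ + (suc k + n)
    contentLow' {b} p with ∈-++⁻ bs p
    ... | inj₁ q = contentLow-step (content b) (+ (k + n)) (contentLow q)
    ... | inj₂ q with t , t<n , refl ← ∈-map-upTo⁻ newBox q = ≤-byDiff _ (diff≥0 cornerLow ⊕ +≥0 t) (contentEq L B (+ t) (+ (k + n)))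
      where
      contentEq : ∀ L B t x → (((L ℤ.+ t) ℤ.- (B ℤ.+ + 1)) ℤ.+ (+ 1 ℤ.+ x)) ℤ.- + 1 ≡ (((L ℤ.- B) ℤ.+ x) ℤ.- + 1) ℤ.+ t
      contentEq = solve-∀
    leftColumn' : ∀ t → t ℕ.< n → ((B ℤ.+ + 1) ℤ.- + t , L) ∈ bs ++ NR
    leftColumn' zero t<n = subst (_∈ bs ++ NR) (cong₂ _,_ (sym (ℤP.+-identityʳ (B ℤ.+ + 1))) (ℤP.+-identityʳ L)) (∈-++⁺ʳ bs (∈-map-upTo⁺ newBox t<n))
    leftColumn' (suc t) t<n = subst (_∈ bs ++ NR) (cong (_, L) (sym (rowEq B (+ t)))) (∈-++⁺ˡ (leftColumn t (ℕP.<-trans (ℕP.n<1+n t) t<n)))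
      where
      rowEq : ∀ B t → (B ℤ.+ + 1) ℤ.- (+ 1 ℤ.+ t) ≡ B ℤ.- t
      rowEq = solve-∀
    rectangle' : ∀ {i j i' j'} → (i , j) ∈ bs ++ NR → (i' , j') ∈ bs ++ NR → i ≤ℤ i' → j ≤ℤ j' → (i , j') ∈ bs ++ NR
    rectangle' p p' ii jj with ∈-++⁻ bs p | ∈-++⁻ bs p'
    ... | inj₁ q | inj₁ q' = ∈-++⁺ˡ (rectangle q q' ii jj)
    ... | inj₁ q | inj₂ q' with t , t<n , refl ← ∈-map-upTo⁻ newBox q' = ∈-++⁺ˡ (rectangle q (bottomRow t t<n) (bottommost q) jj)
    ... | inj₂ q | inj₁ q' with t , _ , refl ← ∈-map-upTo⁻ newBox q = ⊥-elim (+1≤⇒≱ ii (bottommost q'))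
    ... | inj₂ q | inj₂ q' with t , _ , refl ← ∈-map-upTo⁻ newBox q | t' , _ , refl ← ∈-map-upTo⁻ newBox q' = p'

square : ℕ → List Box
square n = concatMap (λ i → map (λ j → (+ i , + j)) (upTo n)) (upTo n)

private
  pos² : ℕ → ℕ → Box
  pos² i j = (+ i , + j)

  square-product : ∀ (xs ys : List ℕ) → concatMap (λ i → map (pos² i) ys) xs ≡ cartesianProductWith pos² xs ys
  square-product [] ys = refl
  square-product (x ∷ xs) ys = cong (map (pos² x) ys ++_) (square-product xs ys)

∈-square⁻ : ∀ {n b} → b ∈ square n → ∃₂ λ i j → i ℕ.< n × j ℕ.< n × b ≡ (+ i , + j)
∈-square⁻ {n} p
  with i , j , pi , pj , e ← ∈-cartesianProductWith⁻ pos² (upTo n) (upTo n) (subst (_ ∈_) (square-product (upTo n) (upTo n)) p)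
  = i , j , ∈-upTo⁻ pi , ∈-upTo⁻ pj , e

∈-square⁺ : ∀ {n i j} → i ℕ.< n → j ℕ.< n → (+ i , + j) ∈ square n
∈-square⁺ {n} i<n j<n = subst (_ ∈_) (sym (square-product (upTo n) (upTo n))) (∈-cartesianProductWith⁺ pos² (∈-upTo⁺ i<n) (∈-upTo⁺ j<n))

square-shape : ∀ n → Shape n 0 (+ 0) (+ n ℤ.- + 1) (square n)
square-shape n = record
  { unique = subst Unique (sym (square-product (upTo n) (upTo n)))
      (UniqueP.cartesianProductWith⁺ pos² (λ { refl → refl , refl }) (UniqueP.upTo⁺ n) (UniqueP.upTo⁺ n))
  ; rowsFromTop = rowsFromTop'
  ; contentLow = contentLow'
  ; rectangle = rectangle'
  ; leftmost = leftmost'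
  ; bottommost = bottommost'
  ; cornerLow = ≤-byDiff 0ℤ ℤP.≤-refl (cornerEq (+ n))
  ; tall = ≤-byDiff 0ℤ ℤP.≤-refl (tallEq (+ n))
  ; leftColumn = leftColumn'
  ; bottomRow = bottomRow'
  }
  where
  cornerEq : ∀ N → ((0ℤ ℤ.- (N ℤ.- + 1)) ℤ.+ N) ℤ.- + 1 ≡ 0ℤ
  cornerEq = solve-∀
  tallEq : ∀ N → ((N ℤ.- + 1) ℤ.+ + 1) ℤ.- N ≡ 0ℤ
  tallEq = solve-∀
  leftmost' : ∀ {b} → b ∈ square n → + 0 ≤ℤ col b
  leftmost' p with i , j , _ , _ , refl ← ∈-square⁻ {n} p = +≥0 j
  bottommost' : ∀ {b} → b ∈ square n → row b ≤ℤ + n ℤ.- + 1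
  bottommost' p with i , j , i<n , _ , refl ← ∈-square⁻ {n} p = ≤-byDiff _ (diff≥0 (ℤ.+≤+ i<n)) (rowEq (+ n) (+ i))
    where
    rowEq : ∀ N I → (N ℤ.- + 1) ℤ.- I ≡ N ℤ.- (+ 1 ℤ.+ I)
    rowEq = solve-∀
  rowsFromTop' : ∀ {b} → b ∈ square n → 0ℤ ≤ℤ row b
  rowsFromTop' p with i , j , _ , _ , refl ← ∈-square⁻ {n} p = +≥0 i
  contentLow' : ∀ {b} → b ∈ square n → + 1 ≤ℤ content b ℤ.+ + (0 + n)
  contentLow' p with i , j , i<n , _ , refl ← ∈-square⁻ {n} p = ≤-byDiff _ (+≥0 j ⊕ diff≥0 (ℤ.+≤+ i<n)) (contentEq (+ j) (+ i) (+ n))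
    where
    contentEq : ∀ J I N → ((J ℤ.- I) ℤ.+ N) ℤ.- + 1 ≡ J ℤ.+ (N ℤ.- (+ 1 ℤ.+ I))
    contentEq = solve-∀
  leftColumn' : ∀ t → t ℕ.< n → ((+ n ℤ.- + 1) ℤ.- + t , + 0) ∈ square n
  leftColumn' t (s≤s {n = m} t≤m) = subst (λ x → ((x ℤ.- + 1) ℤ.- + t , + 0) ∈ square (suc m))
      (cong (λ x → + suc x) (ℕP.m∸n+n≡m t≤m))
      (subst (λ y → (y , + 0) ∈ square (suc m)) (sym (rowEq (+ (m ∸ t)) (+ t)))
        (∈-square⁺ (s≤s (ℕP.m∸n≤m m t)) (s≤s z≤n)))
    where
    rowEq : ∀ D T → ((+ 1 ℤ.+ (D ℤ.+ T)) ℤ.- + 1) ℤ.- T ≡ D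
    rowEq = solve-∀
  bottomRow' : ∀ t → t ℕ.< n → (+ n ℤ.- + 1 , + 0 ℤ.+ + t) ∈ square n
  bottomRow' t (s≤s {n = m} t≤m) = subst (λ y → (y , + t) ∈ square (suc m)) (sym (rowEq (+ m))) (∈-square⁺ ℕP.≤-refl (s≤s t≤m))
    where
    rowEq : ∀ M → (+ 1 ℤ.+ M) ℤ.- + 1 ≡ M
    rowEq = solve-∀
  rectangle' : ∀ {i j i' j'} → (i , j) ∈ square n → (i' , j') ∈ square n → i ≤ℤ i' → j ≤ℤ j' → (i , j') ∈ square n
  rectangle' p p' _ _ with i , j , i<n , _ , refl ← ∈-square⁻ {n} p | i' , j' , _ , j'<n , refl ← ∈-square⁻ {n} p' = ∈-square⁺ {n} i<n j'<n

diagram-shape : ∀ w n → Shape n (length w) (SDiag.leftCol (build w n)) (SDiag.bottomRow (build w n)) (Diagram w n)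
diagram-shape [] n = square-shape n
diagram-shape (c ∷ w) n rewrite build-c w n with build w n | diagram-shape w n
... | sdiag L B bs | S = addColumn-shape S
diagram-shape (r ∷ w) n rewrite build-r w n with build w n | diagram-shape w n
... | sdiag L B bs | S = addRow-shape S

module _ {A : Set} where
  private
    remove : ∀ {x : A} (ys : List A) → x ∈ ys → List A
    remove (y ∷ ys) (here _) = ys
    remove (y ∷ ys) (there p) = y ∷ remove ys p

    length-remove : ∀ {x : A} (ys : List A) (p : x ∈ ys) → suc (length (remove ys p)) ≡ length ys
    length-remove (y ∷ ys) (here _) = refl
    length-remove (y ∷ ys) (there p) = cong suc (length-remove ys p)

    ∈-remove : ∀ {x y : A} {ys} → y ∈ ys → x ≢ y → (p : x ∈ ys) → y ∈ remove ys p
    ∈-remove (here refl) x≢y (here refl) = ⊥-elim (x≢y refl)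
    ∈-remove (here e) _ (there p) = here e
    ∈-remove (there q) _ (here _) = q
    ∈-remove (there q) x≢y (there p) = there (∈-remove q x≢y p)

  unique-⊆⇒length≤ : ∀ {xs ys : List A} → Unique xs → (∀ {x} → x ∈ xs → x ∈ ys) → length xs ≤ length ys
  unique-⊆⇒length≤ {[]} _ _ = z≤n
  unique-⊆⇒length≤ {x ∷ xs} {ys} (x∉xs ∷ u) xs⊆ys =
    subst (suc (length xs) ≤_) (length-remove ys (xs⊆ys (here refl)))
      (s≤s (unique-⊆⇒length≤ u (λ q → ∈-remove (xs⊆ys (there q)) (All.lookup x∉xs q) (xs⊆ys (here refl)))))

unique-map-injectiveOn : ∀ {A B : Set} (f : A → B) {xs : List A} → Unique xs →
  (∀ {x y} → x ∈ xs → y ∈ xs → f x ≡ f y → x ≡ y) → Unique (map f xs)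
unique-map-injectiveOn f {[]} _ _ = []
unique-map-injectiveOn f {x ∷ xs} (x∉xs ∷ u) inj =
  AllP.map⁺ (All.tabulate (λ q e → All.lookup x∉xs q (inj (here refl) (there q) e)))
  ∷ unique-map-injectiveOn f u (λ p q e → inj (there p) (there q) e)

interval-length : ∀ {d m M} (zs : List ℤ) → Unique zs → length zs ≡ suc d → m ≤ℤ M →
  (∀ {z} → z ∈ zs → m ≤ℤ z × z ≤ℤ M) → (∀ z → m ≤ℤ z → z ≤ℤ M → z ∈ zs) → M ≡ m ℤ.+ + d
interval-length {d} {m} {M} zs uzs len m≤M bounded full =
  trans (sym (shift m M)) (cong (λ x → m ℤ.+ x) (trans (sym +e≡M-m) (cong +_ (ℕP.suc-injective e+1≡d+1))))
  where
  shift : ∀ m z → m ℤ.+ (z ℤ.- m) ≡ z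
  shift = solve-∀
  unshift : ∀ m x → (m ℤ.+ x) ℤ.- m ≡ x
  unshift = solve-∀
  e : ℕ
  e = ℤ.∣ M ℤ.- m ∣
  +e≡M-m : + e ≡ M ℤ.- m
  +e≡M-m = ℤP.0≤i⇒+∣i∣≡i (diff≥0 m≤M)
  offset : ℕ → ℤ
  offset t = m ℤ.+ + t
  R : List ℤ
  R = map offset (upTo (suc e))
  ∈R⁻ : ∀ {z} → z ∈ R → m ≤ℤ z × z ≤ℤ M
  ∈R⁻ p with t , q , refl ← ∈-map⁻ offset p with s≤s t≤e ← ∈-upTo⁻ q =
    ℤP.i≤i+j m (+ t) , ≤-byDiff _ (diff≥0 (ℤ.+≤+ t≤e)) (trans (sub M m (+ t)) (cong (ℤ._- + t) (sym +e≡M-m)))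
    where
    sub : ∀ M m t → M ℤ.- (m ℤ.+ t) ≡ (M ℤ.- m) ℤ.- t
    sub = solve-∀
  ∈R⁺ : ∀ {z} → m ≤ℤ z → z ≤ℤ M → z ∈ R
  ∈R⁺ {z} m≤z z≤M = subst (_∈ R) (trans (cong (λ x → m ℤ.+ x) +∣z-m∣) (shift m z))
      (∈-map⁺ offset (∈-upTo⁺ (s≤s (ℤP.drop‿+≤+ (subst₂ _≤ℤ_ (sym +∣z-m∣) (sym +e≡M-m) (ℤP.+-monoˡ-≤ (ℤ.- m) z≤M))))))
    where
    +∣z-m∣ : + ℤ.∣ z ℤ.- m ∣ ≡ z ℤ.- m
    +∣z-m∣ = ℤP.0≤i⇒+∣i∣≡i (diff≥0 m≤z)
  uR : Unique R
  uR = UniqueP.map⁺ (λ {x} {y} e → ℤP.+-injective (trans (sym (unshift m (+ x))) (trans (cong (ℤ._- m) e) (unshift m (+ y))))) (UniqueP.upTo⁺ (suc e))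
  lengthR : length R ≡ suc e
  lengthR = trans (length-map offset (upTo (suc e))) (length-upTo (suc e))
  e+1≡d+1 : suc e ≡ suc d
  e+1≡d+1 = ℕP.≤-antisym
    (subst₂ _≤_ lengthR len (unique-⊆⇒length≤ uR (λ q → full _ (proj₁ (∈R⁻ q)) (proj₂ (∈R⁻ q)))))
    (subst₂ _≤_ len lengthR (unique-⊆⇒length≤ uzs (λ q → ∈R⁺ (proj₁ (bounded q)) (proj₂ (bounded q)))))

-- A skew shape without 2 × 2 squares has at most one box on each diagonal:
-- boxes (i , j) and (i' , j') of one diagonal with i < i' span the square at (i , j).
module _ {S : Box → Set} (skew : IsSkewShape S) (no2x2 : No2x2 S) where
  private
    not-above : ∀ {i j i' j'} → S (i , j) → S (i' , j') → j ℤ.- i ≡ j' ℤ.- i' → ¬ (i <ℤ i')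
    not-above {i} {j} {i'} {j'} sa sb same i<i' =
      no2x2 i j (sa , inS i (j ℤ.+ + 1) ℤP.≤-refl i≤i' (≤+1 j) j+1≤j' , inS (i ℤ.+ + 1) j (≤+1 i) i+1≤i' ℤP.≤-refl j≤j' ,
                 inS (i ℤ.+ + 1) (j ℤ.+ + 1) (≤+1 i) i+1≤i' (≤+1 j) j+1≤j')
      where
      i+1≤i' : i ℤ.+ + 1 ≤ℤ i'
      i+1≤i' = <⇒+1≤ i<i'
      j+1≤j' : j ℤ.+ + 1 ≤ℤ j'
      j+1≤j' = diagonal-right {i} {j} {i'} {j'} same i+1≤i'
      i≤i' : i ≤ℤ i'
      i≤i' = ℤP.<⇒≤ i<i'
      j≤j' : j ≤ℤ j'
      j≤j' = ℤP.≤-trans (≤+1 j) j+1≤j'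
      inS : ∀ x y → i ≤ℤ x → x ≤ℤ i' → j ≤ℤ y → y ≤ℤ j' → S (x , y)
      inS x y = skew (i , j) (i' , j') x y sa sb

  diagonal-injective : ∀ {a b} → S a → S b → content a ≡ content b → a ≡ b
  diagonal-injective {i , j} {i' , j'} sa sb same with ℤP.<-cmp i i'
  ... | tri< i<i' _ _ = ⊥-elim (not-above sa sb same i<i')
  ... | tri> _ _ i'<i = ⊥-elim (not-above sb sa (sym same) i'<i)
  ... | tri≈ _ i≡i' _ = row-content-injective i≡i' same

adjacent-content : ∀ {a b} → Adjacent a b → content b ≤ℤ content a ℤ.+ + 1
adjacent-content {i , j} (inj₁ (refl , inj₁ refl)) = ≤-byDiff 0ℤ ℤP.≤-refl (right i j)
  where
  right : ∀ i j → ((j ℤ.- i) ℤ.+ + 1) ℤ.- ((j ℤ.+ + 1) ℤ.- i) ≡ 0ℤ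
  right = solve-∀
adjacent-content {i , _} {_ , j} (inj₁ (refl , inj₂ refl)) = ≤-byDiff (+ 2) (+≥0 2) (left i j)
  where
  left : ∀ i j → (((j ℤ.+ + 1) ℤ.- i) ℤ.+ + 1) ℤ.- (j ℤ.- i) ≡ + 2
  left = solve-∀
adjacent-content {i , j} (inj₂ (refl , inj₁ refl)) = ≤-byDiff (+ 2) (+≥0 2) (down i j)
  where
  down : ∀ i j → ((j ℤ.- i) ℤ.+ + 1) ℤ.- (j ℤ.- (i ℤ.+ + 1)) ≡ + 2
  down = solve-∀
adjacent-content {_ , j} {i , _} (inj₂ (refl , inj₂ refl)) = ≤-byDiff 0ℤ ℤP.≤-refl (up i j)
  where
  up : ∀ i j → ((j ℤ.- (i ℤ.+ + 1)) ℤ.+ + 1) ℤ.- (j ℤ.- i) ≡ 0ℤ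
  up = solve-∀

path-meets : ∀ {S : Box → Set} {a b} → Star (λ p q → S p × S q × Adjacent p q) a b → S a →
  ∀ δ → content a ≤ℤ δ → δ ≤ℤ content b → ∃ λ x → S x × content x ≡ δ
path-meets {a = a} ε sa δ a≤δ δ≤b = a , sa , ℤP.≤-antisym a≤δ δ≤b
path-meets {a = a} ((_ , sa' , adj) ◅ rest) sa δ a≤δ δ≤b with ℤP.<-cmp (content a) δ
... | tri≈ _ a≡δ _ = a , sa , a≡δ
... | tri> _ _ δ<a = ⊥-elim (ℤP.<⇒≱ δ<a a≤δ)
... | tri< a<δ _ _ = path-meets rest sa' δ (ℤP.≤-trans (adjacent-content adj) (<⇒+1≤ a<δ)) δ≤b

record DiagonalSpan (S : Box → Set) (d : ℕ) : Set where
  field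
    low head : Box
    low∈     : S low
    head∈    : S head
    within   : ∀ {b} → S b → content low ≤ℤ content b × content b ≤ℤ content head
    meets    : ∀ δ → content low ≤ℤ δ → δ ≤ℤ content head → ∃ λ b → S b × content b ≡ δ
    span     : content head ≡ content low ℤ.+ + d

strip-span : ∀ {S : Box → Set} {d} → IsBorderStrip S → (xs : List Box) → Unique xs →
  (∀ {b} → b ∈ xs → S b) → (∀ {b} → S b → b ∈ xs) → length xs ≡ suc d → DiagonalSpan S d
strip-span {S} {d} (skew , connected , no2x2) (x ∷ xs) uxs toS fromS len = record
  { low = low ; head = head ; low∈ = low∈ ; head∈ = head∈ ; within = within ; meets = meets
  ; span = interval-length (map content (x ∷ xs))
      (unique-map-injectiveOn content uxs (λ p q → diagonal-injective skew no2x2 (toS p) (toS q)))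
      (trans (length-map content (x ∷ xs)) len) (proj₁ (within head∈))
      (λ p → let b , b∈ , e = ∈-map⁻ content p in subst (λ z → content low ≤ℤ z × z ≤ℤ content head) (sym e) (within (toS b∈)))
      (λ δ l h → let b , sb , e = meets δ l h in subst (_∈ map content (x ∷ xs)) e (∈-map⁺ content (fromS sb)))
  }
  where
  low head : Box
  low = argmin content x xs
  head = argmax content x xs
  members : All.All (_∈ x ∷ xs) xs
  members = All.tabulate there
  low∈ : S low
  low∈ = toS (argmin-all content {P = _∈ x ∷ xs} (here refl) members)
  head∈ : S head
  head∈ = toS (argmax-all content {P = _∈ x ∷ xs} (here refl) members)
  within : ∀ {b} → S b → content low ≤ℤ content b × content b ≤ℤ content head
  within sb with fromS sb
  ... | here refl = f[argmin]≤f[⊤] {f = content} x xs , f[⊥]≤f[argmax] {f = content} x xs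
  ... | there p = All.lookup (f[argmin]≤f[xs] {f = content} x xs) p , All.lookup (f[xs]≤f[argmax] {f = content} x xs) p
  meets : ∀ δ → content low ≤ℤ δ → δ ≤ℤ content head → ∃ λ b → S b × content b ≡ δ
  meets = path-meets (connected low head low∈ head∈) low∈

-- With M = m + d, the condition "δ + K lies in the window [M + K - d, M + K]"
-- is the condition m ≤ δ ≤ M.  This translates between ψ-values and spans.
window⁺ : ∀ K d {m M δ} → M ≡ m ℤ.+ + d → m ≤ℤ δ → δ ≤ℤ M → δ ℤ.+ K ≤ℤ M ℤ.+ K × M ℤ.+ K ≤ℤ (δ ℤ.+ K) ℤ.+ + d
window⁺ K d {m} {δ = δ} refl m≤δ δ≤M = ℤP.+-monoˡ-≤ K δ≤M , ≤-byDiff _ (diff≥0 m≤δ) (shift m (+ d) δ K)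
  where
  shift : ∀ m d δ K → ((δ ℤ.+ K) ℤ.+ d) ℤ.- ((m ℤ.+ d) ℤ.+ K) ≡ δ ℤ.- m
  shift = solve-∀

window⁻ : ∀ K d {m M δ} → M ≡ m ℤ.+ + d → δ ℤ.+ K ≤ℤ M ℤ.+ K → M ℤ.+ K ≤ℤ (δ ℤ.+ K) ℤ.+ + d → m ≤ℤ δ × δ ≤ℤ M
window⁻ K d {m} {M} {δ} refl lower upper =
  ≤-byDiff _ (diff≥0 upper) (sym (shift m (+ d) δ K)) , ≤-byDiff _ (diff≥0 lower) (sym (unshift M δ K))
  where
  shift : ∀ m d δ K → ((δ ℤ.+ K) ℤ.+ d) ℤ.- ((m ℤ.+ d) ℤ.+ K) ≡ δ ℤ.- m
  shift = solve-∀
  unshift : ∀ M δ K → (M ℤ.+ K) ℤ.- (δ ℤ.+ K) ≡ M ℤ.- δ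
  unshift = solve-∀

-- ψ computed over an arbitrary list of boxes: the largest diagonal number of a
-- box filled with v, or 0 if there is none or all are negative.
module _ (w : Word) (T : Filling) (v : ℕ) where
  maxDiag : List Box → ℤ
  maxDiag = foldr (λ b acc → if ⌊ T b ℕ.≟ v ⌋ then diagNum w b ⊔ acc else acc) (+ 0)

  maxDiag-upper : ∀ xs {b} → b ∈ xs → T b ≡ v → diagNum w b ≤ℤ maxDiag xs
  maxDiag-upper (x ∷ xs) p e with T x ℕ.≟ v
  maxDiag-upper (x ∷ xs) (here refl) e | yes _ = ℤP.i≤i⊔j _ _
  maxDiag-upper (x ∷ xs) (there p) e | yes _ = ℤP.≤-trans (maxDiag-upper xs p e) (ℤP.i≤j⊔i _ _)
  maxDiag-upper (x ∷ xs) (here refl) e | no x≢v = ⊥-elim (x≢v e)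
  maxDiag-upper (x ∷ xs) (there p) e | no _ = maxDiag-upper xs p e

  maxDiag-attained : ∀ xs → maxDiag xs ≡ 0ℤ ⊎ ∃ λ b → b ∈ xs × T b ≡ v × maxDiag xs ≡ diagNum w b
  maxDiag-attained [] = inj₁ refl
  maxDiag-attained (x ∷ xs) with T x ℕ.≟ v
  ... | no _ with maxDiag-attained xs
  ...   | inj₁ e = inj₁ e
  ...   | inj₂ (b , p , e , e') = inj₂ (b , there p , e , e')
  maxDiag-attained (x ∷ xs) | yes x≡v with ℤP.≤-total (diagNum w x) (maxDiag xs)
  ...   | inj₂ x≥ = inj₂ (x , here refl , x≡v , ℤP.i≥j⇒i⊔j≡i x≥)
  ...   | inj₁ x≤ with maxDiag-attained xs
  ...     | inj₁ e = inj₁ (trans (ℤP.i≤j⇒i⊔j≡j x≤) e)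
  ...     | inj₂ (b , p , e , e') = inj₂ (b , there p , e , trans (ℤP.i≤j⇒i⊔j≡j x≤) e')

  maxDiag-head : ∀ xs {h} → h ∈ xs → T h ≡ v → 0ℤ ≤ℤ diagNum w h →
    (∀ {b} → b ∈ xs → T b ≡ v → content b ≤ℤ content h) → maxDiag xs ≡ diagNum w h
  maxDiag-head xs {h} h∈ Th≡v 0≤h maximal with maxDiag-attained xs
  ... | inj₁ e = ℤP.≤-antisym (subst (_≤ℤ diagNum w h) (sym e) 0≤h) (maxDiag-upper xs h∈ Th≡v)
  ... | inj₂ (b , b∈ , Tb≡v , e) =
    ℤP.≤-antisym (subst (_≤ℤ diagNum w h) (sym e) (ℤP.+-monoˡ-≤ (+ (length w + 1)) (maximal b∈ Tb≡v))) (maxDiag-upper xs h∈ Th≡v)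

diagonalOf : Word → ℤ → ℤ
diagonalOf w δ = δ ℤ.+ + (length w + 1)

-- With p = ψ(T) this
-- says the strip of v meets that diagonal (Tableau.covers-own, .covers⇒box),
-- yet it depends on T only through ψ(T).
Covers : Word → ℕ → (ℕ → ℤ) → ℤ → ℕ → Set
Covers w d p δ v = (1 ≤ v) × (v ≤ suc d + length w) × (diagonalOf w δ ≤ℤ p v) × (p v ≤ℤ diagonalOf w δ ℤ.+ + d)

module Tableau (w : Word) (d : ℕ) (T : Filling) (bst : IsBST w (suc d) T) where
  open IsBST bst
  open Shape (diagram-shape w (suc d))
  private
    k : ℕ
    k = length w
    K : ℤ
    K = + (k + 1)

  stripSpan : ∀ v → 1 ≤ v → v ≤ suc d + k → DiagonalSpan (InStrip w (suc d) T v) d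
  stripSpan v 1≤v v≤ = strip-span (strips v 1≤v v≤) (filter filled? (Diagram w (suc d))) (UniqueP.filter⁺ filled? unique)
      (∈-filter⁻ filled? {xs = Diagram w (suc d)}) (λ (b∈ , Tb≡v) → ∈-filter⁺ filled? b∈ Tb≡v) (counts v 1≤v v≤)
    where
    filled? : ∀ b → Dec (T b ≡ v)
    filled? b = T b ℕ.≟ v

  -- This uses
  -- that the head lies on a diagonal numbered ≥ 1: its content is d above the
  -- lowest content of the strip, which is ≥ 1 - (n + k).
  ψ-head : ∀ v (1≤v : 1 ≤ v) (v≤ : v ≤ suc d + k) → ψ w (suc d) T v ≡ diagNum w (DiagonalSpan.head (stripSpan v 1≤v v≤))
  ψ-head v 1≤v v≤ = maxDiag-head w T v (Diagram w (suc d)) (proj₁ head∈) (proj₂ head∈) (ℤP.≤-trans (+≥0 1) 1≤head)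
      (λ b∈ Tb≡v → proj₂ (within (b∈ , Tb≡v)))
    where
    open DiagonalSpan (stripSpan v 1≤v v≤)
    regroup : ∀ m → m ℤ.+ + (k + suc d) ≡ (m ℤ.+ + d) ℤ.+ K
    regroup m = trans (cong (λ z → m ℤ.+ + z) (trans (sym (ℕP.+-assoc k 1 d)) (ℕP.+-comm (k + 1) d)))
                (trans (cong (λ z → m ℤ.+ z) (ℤP.pos-+ d (k + 1))) (sym (ℤP.+-assoc m (+ d) K)))
    1≤head : + 1 ≤ℤ diagNum w head
    1≤head = subst (+ 1 ≤ℤ_) (trans (regroup (content low)) (cong (ℤ._+ K) (sym span))) (contentLow (proj₁ low∈))

  covers-own : ∀ {b} → b ∈ Diagram w (suc d) → Covers w d (ψ w (suc d) T) (content b) (T b)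
  covers-own {b} b∈ with values b b∈
  ... | 1≤v , v≤ = 1≤v , v≤ , subst (λ p → content b ℤ.+ K ≤ℤ p × p ≤ℤ (content b ℤ.+ K) ℤ.+ + d) (sym ψ≡)
                                  (window⁺ K d span (proj₁ (within (b∈ , refl))) (proj₂ (within (b∈ , refl))))
    where
    open DiagonalSpan (stripSpan (T b) 1≤v v≤)
    ψ≡ : ψ w (suc d) T (T b) ≡ diagNum w head
    ψ≡ = ψ-head (T b) 1≤v v≤

  covers⇒box : ∀ {δ v} → Covers w d (ψ w (suc d) T) δ v → ∃ λ x → x ∈ Diagram w (suc d) × T x ≡ v × content x ≡ δ
  covers⇒box {δ} {v} (1≤v , v≤ , lower , upper) =
    let x , (x∈ , Tx≡v) , x≡δ = meets δ (proj₁ inWindow) (proj₂ inWindow) in x , x∈ , Tx≡v , x≡δ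
    where
    open DiagonalSpan (stripSpan v 1≤v v≤)
    ψ≡ : ψ w (suc d) T v ≡ diagNum w head
    ψ≡ = ψ-head v 1≤v v≤
    inWindow : content low ≤ℤ δ × δ ≤ℤ content head
    inWindow = window⁻ K d span (subst (δ ℤ.+ K ≤ℤ_) ψ≡ lower) (subst (_≤ℤ (δ ℤ.+ K) ℤ.+ + d) ψ≡ upper)

  -- Along a diagonal the entries increase strictly downwards: the box (i , j')
  -- between them lies in the diagram, rows and columns weakly increase, and equal
  -- entries would put two boxes of one diagonal into one strip.
  diagonal-increasing : ∀ {a b} → a ∈ Diagram w (suc d) → b ∈ Diagram w (suc d) →
    content a ≡ content b → row a <ℤ row b → T a ℕ.< T b
  diagonal-increasing {i , j} {i' , j'} a∈ b∈ same i<i' = ℕP.≤∧≢⇒< (ℕP.≤-trans along-row down-column) distinct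
    where
    j≤j' : j ≤ℤ j'
    j≤j' = ℤP.≤-trans (≤+1 j) (diagonal-right {i} {j} {i'} {j'} same (<⇒+1≤ i<i'))
    corner∈ : (i , j') ∈ Diagram w (suc d)
    corner∈ = rectangle a∈ b∈ (ℤP.<⇒≤ i<i') j≤j'
    along-row : T (i , j) ≤ T (i , j')
    along-row = rowsWeak i j j' a∈ corner∈ j≤j'
    down-column : T (i , j') ≤ T (i' , j')
    down-column = colsWeak i i' j' corner∈ b∈ (ℤP.<⇒≤ i<i')
    distinct : T (i , j) ≢ T (i' , j')
    distinct Ta≡Tb with 1≤v , v≤ ← values (i , j) a∈ with skew , _ , no2x2 ← strips (T (i , j)) 1≤v v≤
      with refl ← diagonal-injective skew no2x2 (a∈ , refl) (b∈ , sym Ta≡Tb) same = ℤP.<-irrefl refl i<i'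

covers-transport : ∀ {w d p q δ v} → (∀ j → 1 ≤ j → j ≤ suc d + length w → p j ≡ q j) → Covers w d q δ v → Covers w d p δ v
covers-transport {w} {d} {p} {q} {δ} {v} p≡q (1≤v , v≤ , lower , upper) =
  1≤v , v≤ , subst (diagonalOf w δ ≤ℤ_) (sym p≡q') lower , subst (_≤ℤ diagonalOf w δ ℤ.+ + d) (sym p≡q') upper
  where
  p≡q' : p v ≡ q v
  p≡q' = p≡q _ 1≤v v≤

SameΨ : Word → ℕ → Filling → Filling → Set
SameΨ w n T T' = ∀ j → 1 ≤ j → j ≤ n + length w → ψ w n T j ≡ ψ w n T' j

module Comparison (w : Word) (d : ℕ) (T T' : Filling) (bst : IsBST w (suc d) T) (bst' : IsBST w (suc d) T')
                  (sameψ : SameΨ w (suc d) T T') where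
  private
    module 𝕋 = Tableau w d T bst
    module 𝕋' = Tableau w d T' bst'

  -- Suppose T and T' agree on the boxes
  -- above b on its diagonal.  The strip of v = T' b in T meets that diagonal in
  -- a box x.  Were x above b, then T' x = T x = v = T' b, contradicting
  -- diagonal-increasing for T'; so x is b or lies below it, and T b ≤ T x = v.
  ≤-fromAgreementAbove : ∀ {b} → b ∈ Diagram w (suc d) →
    (∀ {x} → x ∈ Diagram w (suc d) → content x ≡ content b → row x <ℤ row b → T x ≡ T' x) → T b ≤ T' b
  ≤-fromAgreementAbove {b} b∈ agree with x , x∈ , Tx≡v , x≡b ← 𝕋.covers⇒box (covers-transport {w} {d} {δ = content b} sameψ (𝕋'.covers-own b∈))
    with ℤP.<-cmp (row x) (row b)
  ... | tri< x<b _ _ = ⊥-elim (ℕP.<-irrefl (trans (sym (agree x∈ x≡b x<b)) Tx≡v) (𝕋'.diagonal-increasing x∈ b∈ x≡b x<b))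
  ... | tri≈ _ sameRow _ = ℕP.≤-reflexive (trans (cong T (row-content-injective (sym sameRow) (sym x≡b))) Tx≡v)
  ... | tri> _ _ b<x = ℕP.<⇒≤ (subst (T b ℕ.<_) Tx≡v (𝕋.diagonal-increasing b∈ x∈ (sym x≡b) b<x))

agree-above-row : ∀ w d T T' (bst : IsBST w (suc d) T) (bst' : IsBST w (suc d) T') → SameΨ w (suc d) T T' →
  ∀ m {b} → b ∈ Diagram w (suc d) → row b <ℤ + m → T b ≡ T' b
agree-above-row w d T T' bst bst' sameψ zero b∈ b<0 = ⊥-elim (ℤP.<⇒≱ b<0 (Shape.rowsFromTop (diagram-shape w (suc d)) b∈))
agree-above-row w d T T' bst bst' sameψ (suc m) {b} b∈ b<m+1 =
  ℕP.≤-antisym (Comparison.≤-fromAgreementAbove w d T T' bst bst' sameψ b∈ (λ x∈ _ x<b → agreeAbove x∈ (above x<b)))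
               (Comparison.≤-fromAgreementAbove w d T' T bst' bst (λ j 1≤j j≤ → sym (sameψ j 1≤j j≤)) b∈
                  (λ x∈ _ x<b → sym (agreeAbove x∈ (above x<b))))
  where
  agreeAbove : ∀ {x} → x ∈ Diagram w (suc d) → row x <ℤ + m → T x ≡ T' x
  agreeAbove = agree-above-row w d T T' bst bst' sameψ m
  above : ∀ {i} → i <ℤ row b → i <ℤ + m
  above x<b = ℤP.<-≤-trans x<b (ℤP.i<j⇒i≤pred[j] b<m+1)

mainTheorem9 : (w : Word) (n : ℕ) → 1 ≤ n → (T T' : Filling) →
    IsBST w n T → IsBST w n T' →
    (∀ j → 1 ≤ j → j ≤ n + length w → ψ w n T j ≡ ψ w n T' j) →
    ∀ b → b ∈ Diagram w n → T b ≡ T' b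
mainTheorem9 w (suc d) _ T T' bst bst' sameψ b b∈ =
  agree-above-row w d T T' bst bst' sameψ (suc ℤ.∣ row b ∣) b∈ (subst (_<ℤ + suc ℤ.∣ row b ∣) row≡ (ℤ.+<+ ℕP.≤-refl))
  where
  row≡ : + ℤ.∣ row b ∣ ≡ row b
  row≡ = ℤP.0≤i⇒+∣i∣≡i (Shape.rowsFromTop (diagram-shape w (suc d)) b∈)
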